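{- Let $A^{\tau}(t,z)=\sum_{n,k\ge0}a^{\tau}_{n,k}t^nz^k$, where $a^{\tau}_{n,k}$ is the number of permutations in $S_n$ avoiding the classical pattern $3\textrm{ - }1\textrm{ - }2$ and containing exactly $k$ occurrences of the consecutive pattern $\tau$. Then $A^{132}(t,z)=A^{231}(t,z)$.
   Context: A permutation $\sigma\in S_n$ avoids the classical pattern $3\textrm{ - }1\textrm{ - }2$ if there are no indices $i<j<l$ with $\sigma(j)<\sigma(l)<\sigma(i)$. An occurrence of the consecutive pattern $132$ (resp. $231$) in $\sigma$ is an index $i$ with $\sigma(i)<\sigma(i+2)<\sigma(i+1)$ (resp. $\sigma(i+2)<\sigma(i)<\sigma(i+1)$). -}

module Defs where

open import Data.Nat using (ℕ; zero; suc; _+_; _<ᵇ_)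
open import Data.Bool using (Bool; true; false; if_then_else_; _∧_)
open import Data.Fin using (Fin; toℕ) renaming (_<_ to _<ᶠ_)
open import Data.Fin.Properties using (all?) renaming (_<?_ to _<ᶠ?_; _≟_ to _≟ᶠ_)
open import Data.Vec using (Vec; []; _∷_; lookup; toList)
import Data.Vec as Vec
open import Data.List using (List; []; _∷_; [_]; length; filter; concatMap; map; allFin)
open import Data.Product using (_×_)
open import Relation.Binary.PropositionalEquality using (_≡_)
open import Relation.Nullary using (¬_; Dec)
open import Relation.Nullary.Decidable using (_×-dec_; _→-dec_; ¬?)
import Data.Nat.Properties as ℕP

-- A word of length n over Fin n; it is a permutation of S_n (one-line
-- notation σ(0) … σ(n-1), values 0..n-1) iff it is injective.
IsPerm : ∀ {n} → Vec (Fin n) n → Set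
IsPerm {n} σ = ∀ (i j : Fin n) → lookup σ i ≡ lookup σ j → i ≡ j

Avoids312 : ∀ {n} → Vec (Fin n) n → Set
Avoids312 {n} σ = ∀ (i j l : Fin n) → i <ᶠ j → j <ᶠ l →
  ¬ (lookup σ j <ᶠ lookup σ l × lookup σ l <ᶠ lookup σ i)

occ132 : List ℕ → ℕ
occ132 (a ∷ b ∷ c ∷ w) =
  (if (a <ᵇ c) ∧ (c <ᵇ b) then 1 else 0) + occ132 (b ∷ c ∷ w)
occ132 _ = 0

occ231 : List ℕ → ℕ
occ231 (a ∷ b ∷ c ∷ w) =
  (if (c <ᵇ a) ∧ (a <ᵇ b) then 1 else 0) + occ231 (b ∷ c ∷ w)
occ231 _ = 0

word : ∀ {n} → Vec (Fin n) n → List ℕ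
word σ = toList (Vec.map toℕ σ)

isPerm? : ∀ {n} (σ : Vec (Fin n) n) → Dec (IsPerm σ)
isPerm? σ = all? λ i → all? λ j → (lookup σ i ≟ᶠ lookup σ j) →-dec (i ≟ᶠ j)

avoids312? : ∀ {n} (σ : Vec (Fin n) n) → Dec (Avoids312 σ)
avoids312? σ = all? λ i → all? λ j → all? λ l →
  (i <ᶠ? j) →-dec (j <ᶠ? l) →-dec
    ¬? ((lookup σ j <ᶠ? lookup σ l) ×-dec (lookup σ l <ᶠ? lookup σ i))

allVecs : (m n : ℕ) → List (Vec (Fin m) n)
allVecs m zero = [ [] ]
allVecs m (suc n) = concatMap (λ x → map (x ∷_) (allVecs m n)) (allFin m)

a : (List ℕ → ℕ) → ℕ → ℕ → ℕ
a occ n k = length (filter (λ σ → isPerm? σ ×-dec avoids312? σ ×-dec (occ (word σ) ℕP.≟ k))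
                           (allVecs n n))

-- A 312-avoiding permutation of {o, …, o+n−1} factors as α o β around its least entry o,
-- where α and β avoid 312 and every entry of α lies below every entry of β (x ∈ α, o, y ∈ β
-- with y < x would be a 312). So these permutations are the in-order labellings of binary
-- trees, and reflecting the tree is an involution on them. A consecutive triple through o is a
-- 132 exactly when o is followed by a descent opening β, and a 231 exactly when an ascent
-- closing α is followed by o. Reflection moves the right subtree to the left, and a descent
-- opening its word becomes an ascent closing the word of its mirror image; so induction on the
-- tree shows that reflection turns consecutive 132s into consecutive 231s, and counting
-- through this involution gives the theorem.

module Submission where

open import Defs
open import Level using (0ℓ)
open import Data.Bool using (true; false; if_then_else_; _∧_)
open import Data.Bool.Properties using (∧-zeroʳ)
open import Data.Nat using (ℕ; zero; suc; _+_; _≤_; _<_; z≤n; s≤s; _<ᵇ_)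
open import Data.Nat.Properties
  using (_≟_; ≤-refl; ≤-trans; ≤-antisym; <⇒≤; <-asym; <-≤-trans; ≤⇒≯; ≮⇒≥; ≤∧≢⇒<; <-irrefl; 1+n≰n;
         m≤m+n; m≤n+m; +-comm; +-assoc; +-suc; +-identityʳ; suc-injective)
open import Data.Nat.Induction using (<-rec)
open import Data.Nat.DivMod using (_mod_; m<n⇒m%n≡m)
open import Data.Fin using (Fin; toℕ; fromℕ<; punchOut) renaming (zero to fzero; suc to fsuc; _<_ to _<ᶠ_)
open import Data.Fin.Properties
  using (toℕ-fromℕ<; toℕ-injective; toℕ<n; punchOut-injective; any?; injective⇒≤)
  renaming (_≟_ to _≟ᶠ_; suc-injective to fsuc-injective)
open import Data.Vec using (Vec; []; _∷_; lookup; toList)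
import Data.Vec as Vec
import Data.Vec.Properties as Vecₚ
open import Data.List using (List; []; _∷_; [_]; _++_; length; map; filter; concatMap; cartesianProductWith; allFin)
open import Data.List.Properties using (length-map; length-++; ++-assoc; ++-conicalʳ; ∷-injective; filter-≐)
open import Data.List.Membership.Propositional using (_∈_; _∉_)
open import Data.List.Membership.Propositional.Properties
  using (∈-map⁺; ∈-allFin; ∈-cartesianProductWith⁺; ∈-∃++; ∈-++⁻; ∈-++⁺ˡ; ∈-++⁺ʳ)
open import Data.List.Membership.Propositional.Properties.WithK using (unique∧set⇒bag)
open import Data.List.Relation.Unary.Any using (here; there)
open import Data.List.Relation.Unary.All using (All; []; _∷_)
import Data.List.Relation.Unary.All as All
open import Data.List.Relation.Unary.AllPairs using ([]; _∷_)
open import Data.List.Relation.Unary.Unique.Propositional using (Unique)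
import Data.List.Relation.Unary.Unique.Propositional.Properties as Uniqueₚ
open import Data.List.Relation.Binary.Sublist.Propositional using (_⊆_; []; _∷_; _∷ʳ_; ⊆-refl; ⊆-trans; from∈; to∈)
open import Data.List.Relation.Binary.Sublist.Propositional.Properties
  using (∷ˡ⁻) renaming (++⁺ to ⊆-++⁺; ++⁺ˡ to ⊆-++⁺ˡ; ++⁺ʳ to ⊆-++⁺ʳ)
open import Data.List.Relation.Binary.Permutation.Propositional
  using (_↭_; ↭-refl; ↭-sym; ↭-trans; ↭-prep; ↭-reflexive; ↭⇒↭ₛ; module PermutationReasoning)
open import Data.List.Relation.Binary.Permutation.Propositional.Properties
  using (∈-resp-↭; ↭-length; ↭-empty-inv; drop-mid; shift; ++⁺; filter-↭)
open import Data.List.Relation.Binary.BagAndSetEquality using (∼bag⇒↭)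
open import Data.Product using (∃; ∃₂; _×_; _,_; proj₁; proj₂)
open import Data.Sum using (inj₁; inj₂)
open import Function using (_∘_; case_of_; mk⇔)
open import Relation.Nullary using (¬_; does; yes; no; contradiction)
open import Relation.Nullary.Decidable using (_×-dec_)
open import Relation.Unary using (Pred; Decidable; _≐_)
open import Relation.Binary.PropositionalEquality
  using (_≡_; _≢_; refl; cong; cong₂; subst; sym; trans; setoid; module ≡-Reasoning)
open import Data.List.Relation.Binary.Permutation.Setoid.Properties (setoid ℕ) using (Unique-resp-↭)

-- Counting through an involution

module _ {A : Set} {P : Pred A 0ℓ} (P? : Decidable P) (f : A → A) where

  filter-map : ∀ xs → filter P? (map f xs) ≡ map f (filter (P? ∘ f) xs)
  filter-map [] = refl
  filter-map (x ∷ xs) with does (P? (f x))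
  ... | true  = cong (f x ∷_) (filter-map xs)
  ... | false = filter-map xs

module _ {A : Set} (f : A → A) (f-involutive : ∀ x → f (f x) ≡ x) where

  map-involution-↭ : ∀ {xs} → Unique xs → (∀ x → x ∈ xs) → map f xs ↭ xs
  map-involution-↭ {xs} xs! complete = ∼bag⇒↭ (unique∧set⇒bag
    (Uniqueₚ.map⁺ injective xs!) xs!
    (mk⇔ (λ _ → complete _) (λ _ → subst (_∈ map f xs) (f-involutive _) (∈-map⁺ f (complete _)))))
    where
    injective : ∀ {x y} → f x ≡ f y → x ≡ y
    injective {x} {y} fx≡fy = trans (sym (f-involutive x)) (trans (cong f fx≡fy) (f-involutive y))

  length-filter-involution : ∀ {P Q : Pred A 0ℓ} (P? : Decidable P) (Q? : Decidable Q) {xs} →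
    Unique xs → (∀ x → x ∈ xs) → P ≐ Q ∘ f →
    length (filter P? xs) ≡ length (filter Q? xs)
  length-filter-involution P? Q? {xs} xs! complete P≐Q∘f = begin
    length (filter P? xs)             ≡⟨ cong length (filter-≐ P? (Q? ∘ f) P≐Q∘f xs) ⟩
    length (filter (Q? ∘ f) xs)       ≡⟨ length-map f (filter (Q? ∘ f) xs) ⟨
    length (map f (filter (Q? ∘ f) xs)) ≡⟨ cong length (filter-map Q? f xs) ⟨
    length (filter Q? (map f xs))     ≡⟨ ↭-length (filter-↭ Q? (map-involution-↭ xs! complete)) ⟩
    length (filter Q? xs)             ∎
    where open ≡-Reasoning

allVecs-cartesian : ∀ m n → allVecs m (suc n) ≡ cartesianProductWith _∷_ (allFin m) (allVecs m n)
allVecs-cartesian m n = go (allFin m)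
  where
  go : ∀ xs → concatMap (λ x → map (x ∷_) (allVecs m n)) xs ≡ cartesianProductWith _∷_ xs (allVecs m n)
  go [] = refl
  go (x ∷ xs) = cong (map (x ∷_) (allVecs m n) ++_) (go xs)

∈-allVecs : ∀ {m n} (v : Vec (Fin m) n) → v ∈ allVecs m n
∈-allVecs [] = here refl
∈-allVecs {m} {suc n} (x ∷ v) = subst (_ ∈_) (sym (allVecs-cartesian m n))
  (∈-cartesianProductWith⁺ _∷_ (∈-allFin x) (∈-allVecs v))

allVecs-unique : ∀ m n → Unique (allVecs m n)
allVecs-unique m zero = All.[] ∷ []
allVecs-unique m (suc n) = subst Unique (sym (allVecs-cartesian m n))
  (Uniqueₚ.cartesianProductWith⁺ _∷_ Vecₚ.∷-injective (Uniqueₚ.allFin⁺ m) (allVecs-unique m n))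

interval : ℕ → ℕ → List ℕ
interval o zero    = []
interval o (suc n) = o ∷ interval (suc o) n

length-interval : ∀ o n → length (interval o n) ≡ n
length-interval o zero    = refl
length-interval o (suc n) = cong suc (length-interval (suc o) n)

∈-interval⁻ : ∀ {o n x} → x ∈ interval o n → o ≤ x × x < o + n
∈-interval⁻ {o} {suc n} (here refl) = ≤-refl , subst (o <_) (sym (+-suc o n)) (s≤s (m≤m+n o n))
∈-interval⁻ {o} {suc n} {x} (there x∈) with ∈-interval⁻ x∈
... | o<x , x<o+n = <⇒≤ o<x , subst (x <_) (sym (+-suc o n)) x<o+n

∈-interval⁺ : ∀ {o n x} → o ≤ x → x < o + n → x ∈ interval o n
∈-interval⁺ {o} {zero}  o≤x x<o+0 = contradiction (subst (_ <_) (+-identityʳ o) x<o+0) (≤⇒≯ o≤x)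
∈-interval⁺ {o} {suc n} {x} o≤x x<o+n with o ≟ x
... | yes refl = here refl
... | no  o≢x  = there (∈-interval⁺ (≤∧≢⇒< o≤x o≢x) (subst (x <_) (+-suc o n) x<o+n))

interval-unique : ∀ o n → Unique (interval o n)
interval-unique o zero    = []
interval-unique o (suc n) = All.tabulate (λ x∈ o≡x → <-irrefl o≡x (proj₁ (∈-interval⁻ x∈))) ∷ interval-unique (suc o) n

interval-++ : ∀ o p q → interval o (p + q) ≡ interval o p ++ interval (o + p) q
interval-++ o zero    q = cong (λ o′ → interval o′ q) (sym (+-identityʳ o))
interval-++ o (suc p) q = cong (o ∷_) (trans (interval-++ (suc o) p q) (cong (λ o′ → interval (suc o) p ++ interval o′ q) (sym (+-suc o p))))

left-contains-minimum : ∀ {o n} u {w} → length u ≡ suc n → o ∈ u ++ w → All (o ≤_) u →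
  (∀ {x y} → x ∈ u → y ∈ w → ¬ y < x) → o ∈ u
left-contains-minimum (x ∷ u) _ o∈u++w (o≤x ∷ _) sep with ∈-++⁻ (x ∷ u) o∈u++w
... | inj₁ o∈u = o∈u
... | inj₂ o∈w = here (≤-antisym o≤x (≮⇒≥ (sep (here refl) o∈w)))

↭-interval-split : ∀ p q o (u w : List ℕ) → length u ≡ p → u ++ w ↭ interval o (p + q) →
  (∀ {x y} → x ∈ u → y ∈ w → ¬ y < x) → u ↭ interval o p × w ↭ interval (o + p) q
↭-interval-split zero q o [] w refl u++w↭ sep =
  ↭-refl , subst (λ o′ → w ↭ interval o′ q) (sym (+-identityʳ o)) u++w↭
↭-interval-split (suc p) q o u w |u|≡ u++w↭ sep
  with ∈-∃++ (left-contains-minimum u |u|≡ (∈-resp-↭ (↭-sym u++w↭) (here refl))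
                (All.tabulate (λ x∈u → proj₁ (∈-interval⁻ (∈-resp-↭ u++w↭ (∈-++⁺ˡ x∈u))))) sep)
... | u₁ , u₂ , refl =
  ↭-trans (shift o u₁ u₂) (↭-prep o (proj₁ split)) , subst (λ o′ → w ↭ interval o′ q) (sym (+-suc o p)) (proj₂ split)
  where
  |u₁++u₂| : length (u₁ ++ u₂) ≡ p
  |u₁++u₂| = suc-injective (begin
    suc (length (u₁ ++ u₂))          ≡⟨ cong suc (length-++ u₁) ⟩
    suc (length u₁ + length u₂)      ≡⟨ +-suc (length u₁) (length u₂) ⟨
    length u₁ + length (o ∷ u₂)      ≡⟨ length-++ u₁ ⟨
    length (u₁ ++ o ∷ u₂)            ≡⟨ |u|≡ ⟩
    suc p                            ∎)
    where open ≡-Reasoning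
  u₁++u₂++w↭ : (u₁ ++ u₂) ++ w ↭ interval (suc o) (p + q)
  u₁++u₂++w↭ = ↭-trans (↭-reflexive (++-assoc u₁ u₂ w))
    (drop-mid u₁ [] (↭-trans (↭-reflexive (sym (++-assoc u₁ (o ∷ u₂) w))) u++w↭))
  sep′ : ∀ {x y} → x ∈ u₁ ++ u₂ → y ∈ w → ¬ y < x
  sep′ x∈ with ∈-++⁻ u₁ x∈
  ... | inj₁ x∈u₁ = sep (∈-++⁺ˡ x∈u₁)
  ... | inj₂ x∈u₂ = sep (∈-++⁺ʳ u₁ (there x∈u₂))
  split = ↭-interval-split p q (suc o) (u₁ ++ u₂) w |u₁++u₂| u₁++u₂++w↭ sep′

-- 312-avoiding words and binary trees

Avoids312ʷ : List ℕ → Set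
Avoids312ʷ w = ∀ {x y z} → x ∷ y ∷ z ∷ [] ⊆ w → ¬ (y < z × z < x)

⊆-++⁻ : ∀ (u : List ℕ) {p w} → p ⊆ u ++ w → ∃₂ λ p₁ p₂ → p ≡ p₁ ++ p₂ × p₁ ⊆ u × p₂ ⊆ w
⊆-++⁻ []      p⊆w          = [] , _ , refl , [] , p⊆w
⊆-++⁻ (x ∷ u) (_ ∷ʳ p⊆)    with ⊆-++⁻ u p⊆
... | p₁ , p₂ , refl , p₁⊆u , p₂⊆w = p₁ , p₂ , refl , x ∷ʳ p₁⊆u , p₂⊆w
⊆-++⁻ (x ∷ u) (refl ∷ p⊆) with ⊆-++⁻ u p⊆
... | p₁ , p₂ , refl , p₁⊆u , p₂⊆w = x ∷ p₁ , p₂ , refl , refl ∷ p₁⊆u , p₂⊆w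

∷⊆⇒∈ : ∀ {x p} {w : List ℕ} → x ∷ p ⊆ w → x ∈ w
∷⊆⇒∈ (_ ∷ʳ x∷p⊆) = there (∷⊆⇒∈ x∷p⊆)
∷⊆⇒∈ (refl ∷ _)  = here refl

avoids312-around-min : ∀ {m} {u w : List ℕ} → Avoids312ʷ u → Avoids312ʷ w →
  All (m <_) u → All (m <_) w → (∀ {x z} → x ∈ u → z ∈ w → x < z) → Avoids312ʷ (u ++ m ∷ w)
avoids312-around-min {m} {u} {w} av-u av-w m<u m<w u<w s (y<z , z<x) with ⊆-++⁻ u s
... | _ ∷ _ ∷ _ ∷ [] , [] , refl , xyz⊆u , _        = av-u xyz⊆u (y<z , z<x)
... | [] , _ , refl , _ , (_ ∷ʳ xyz⊆w)               = av-w xyz⊆w (y<z , z<x)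
... | [] , _ , refl , _ , (refl ∷ yz⊆w)              = <-asym (All.lookup m<w (∷⊆⇒∈ (∷ˡ⁻ yz⊆w))) z<x
... | _ ∷ [] , _ , refl , x⊆u , (_ ∷ʳ yz⊆w)          = <-asym (u<w (∷⊆⇒∈ x⊆u) (∷⊆⇒∈ (∷ˡ⁻ yz⊆w))) z<x
... | _ ∷ [] , _ , refl , x⊆u , (refl ∷ z⊆w)         = <-asym (u<w (∷⊆⇒∈ x⊆u) (∷⊆⇒∈ z⊆w)) z<x
... | _ ∷ _ ∷ [] , _ , refl , xy⊆u , (_ ∷ʳ z⊆w)      = <-asym (u<w (∷⊆⇒∈ xy⊆u) (∷⊆⇒∈ z⊆w)) z<x
... | _ ∷ _ ∷ [] , _ , refl , xy⊆u , (refl ∷ _)      = <-asym (All.lookup m<u (∷⊆⇒∈ (∷ˡ⁻ xy⊆u))) y<z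

data Tree : Set where
  leaf : Tree
  node : Tree → Tree → Tree

size : Tree → ℕ
size leaf       = 0
size (node l r) = suc (size l + size r)

mirror : Tree → Tree
mirror leaf       = leaf
mirror (node l r) = node (mirror r) (mirror l)

mirror-involutive : ∀ t → mirror (mirror t) ≡ t
mirror-involutive leaf       = refl
mirror-involutive (node l r) = cong₂ node (mirror-involutive l) (mirror-involutive r)

size-mirror : ∀ t → size (mirror t) ≡ size t
size-mirror leaf       = refl
size-mirror (node l r) = cong suc (trans (cong₂ _+_ (size-mirror r) (size-mirror l)) (+-comm (size r) (size l)))

encode : ℕ → Tree → List ℕ
encode o leaf       = []
encode o (node l r) = encode (suc o) l ++ o ∷ encode (suc o + size l) r

encode-↭ : ∀ o t → encode o t ↭ interval o (size t)
encode-↭ o leaf       = ↭-refl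
encode-↭ o (node l r) = begin
  encode (suc o) l ++ o ∷ encode (suc o + size l) r            ↭⟨ shift o (encode (suc o) l) _ ⟩
  o ∷ encode (suc o) l ++ encode (suc o + size l) r            ↭⟨ ↭-prep o (++⁺ (encode-↭ (suc o) l) (encode-↭ (suc o + size l) r)) ⟩
  o ∷ interval (suc o) (size l) ++ interval (suc o + size l) (size r) ≡⟨ cong (o ∷_) (interval-++ (suc o) (size l) (size r)) ⟨
  interval o (size (node l r))                                  ∎
  where open PermutationReasoning

length-encode : ∀ o t → length (encode o t) ≡ size t
length-encode o t = trans (↭-length (encode-↭ o t)) (length-interval o (size t))

∈-encode⁻ : ∀ o t {x} → x ∈ encode o t → o ≤ x × x < o + size t
∈-encode⁻ o t x∈ = ∈-interval⁻ (∈-resp-↭ (encode-↭ o t) x∈)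

encode-lower : ∀ o t → All (o ≤_) (encode o t)
encode-lower o t = All.tabulate (λ x∈ → proj₁ (∈-encode⁻ o t x∈))

right-above-root : ∀ o l r → All (o <_) (encode (suc o + size l) r)
right-above-root o l r = All.map (<-≤-trans (s≤s (m≤m+n o (size l)))) (encode-lower (suc o + size l) r)

encode-avoids312 : ∀ o t → Avoids312ʷ (encode o t)
encode-avoids312 o leaf ()
encode-avoids312 o (node l r) =
  avoids312-around-min (encode-avoids312 (suc o) l) (encode-avoids312 (suc o + size l) r)
    (encode-lower (suc o) l) (right-above-root o l r)
    (λ x∈ z∈ → <-≤-trans (proj₂ (∈-encode⁻ (suc o) l x∈)) (proj₁ (∈-encode⁻ (suc o + size l) r z∈)))

++-∷-cancel : ∀ {c} (u u′ : List ℕ) {w w′} → c ∉ u → c ∉ u′ → u ++ c ∷ w ≡ u′ ++ c ∷ w′ → u ≡ u′ × w ≡ w′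
++-∷-cancel []      []       _   _    eq = refl , proj₂ (∷-injective eq)
++-∷-cancel []      (x ∷ u′) _   c∉u′ eq = contradiction (here (proj₁ (∷-injective eq))) c∉u′
++-∷-cancel (x ∷ u) []       c∉u _    eq = contradiction (here (sym (proj₁ (∷-injective eq)))) c∉u
++-∷-cancel (x ∷ u) (x′ ∷ u′) c∉u c∉u′ eq with ∷-injective eq
... | refl , eq′ with ++-∷-cancel u u′ (c∉u ∘ there) (c∉u′ ∘ there) eq′
... | refl , refl = refl , refl

encode-injective : ∀ o t t′ → encode o t ≡ encode o t′ → t ≡ t′
encode-injective o leaf       leaf         _  = refl
encode-injective o leaf       (node l′ r′) eq = case ++-conicalʳ (encode (suc o) l′) _ (sym eq) of λ ()
encode-injective o (node l r) leaf         eq = case ++-conicalʳ (encode (suc o) l) _ eq of λ ()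
encode-injective o (node l r) (node l′ r′) eq
  with ++-∷-cancel (encode (suc o) l) (encode (suc o) l′) (o∉ l) (o∉ l′) eq
  where
  o∉ : ∀ t → o ∉ encode (suc o) t
  o∉ t o∈ = <-irrefl refl (proj₁ (∈-encode⁻ (suc o) t o∈))
... | eqˡ , eqʳ with encode-injective (suc o) l l′ eqˡ
... | refl = cong (node l) (encode-injective (suc o + size l) r r′ eqʳ)

avoids312-⊆ : ∀ {p w} → p ⊆ w → Avoids312ʷ w → Avoids312ʷ p
avoids312-⊆ p⊆w av s = av (⊆-trans s p⊆w)

Decodable : ℕ → Set
Decodable n = ∀ o w → w ↭ interval o n → Avoids312ʷ w → ∃ λ t → w ≡ encode o t

decode : ∀ n → Decodable n
decode = <-rec Decodable step
  where
  step : ∀ n → (∀ {m} → m < n → Decodable m) → Decodable n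
  step zero    _   o w w↭ _ = leaf , ↭-empty-inv w↭
  step (suc n) rec o w w↭ av with ∈-∃++ (∈-resp-↭ (↭-sym w↭) (here refl))
  ... | u , v , refl = node tu tv , cong₂ (λ u′ v′ → u′ ++ o ∷ v′) u≡ (trans v≡ (cong (λ s → encode (suc o + s) tv) |u|≡))
    where
    u++v↭ : u ++ v ↭ interval (suc o) n
    u++v↭ = drop-mid u [] w↭
    |u|+|v| : length u + length v ≡ n
    |u|+|v| = trans (sym (length-++ u)) (trans (↭-length u++v↭) (length-interval (suc o) n))
    sep : ∀ {x y} → x ∈ u → y ∈ v → ¬ y < x
    sep x∈u y∈v y<x = av (⊆-++⁺ (from∈ x∈u) (refl ∷ from∈ y∈v)) (o<y , y<x)
      where o<y = proj₁ (∈-interval⁻ (∈-resp-↭ u++v↭ (∈-++⁺ʳ u y∈v)))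
    split = ↭-interval-split (length u) (length v) (suc o) u v refl
      (subst (λ k → u ++ v ↭ interval (suc o) k) (sym |u|+|v|) u++v↭) sep
    decode-u = rec (s≤s (subst (length u ≤_) |u|+|v| (m≤m+n _ _))) (suc o) u (proj₁ split)
      (avoids312-⊆ (⊆-++⁺ʳ (o ∷ v) ⊆-refl) av)
    decode-v = rec (s≤s (subst (length v ≤_) |u|+|v| (m≤n+m _ _))) (suc o + length u) v (proj₂ split)
      (avoids312-⊆ (⊆-++⁺ˡ u (o ∷ʳ ⊆-refl)) av)
    tu = proj₁ decode-u
    tv = proj₁ decode-v
    u≡ = proj₂ decode-u
    v≡ = proj₂ decode-v
    |u|≡ : length u ≡ size tu
    |u|≡ = trans (cong length u≡) (length-encode (suc o) tu)

-- Consecutive patterns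

<ᵇ-true : ∀ {m n} → m < n → (m <ᵇ n) ≡ true
<ᵇ-true {zero}  (s≤s _)   = refl
<ᵇ-true {suc m} (s≤s m<n) = <ᵇ-true m<n

<ᵇ-false : ∀ {m n} → n ≤ m → (m <ᵇ n) ≡ false
<ᵇ-false z≤n       = refl
<ᵇ-false (s≤s n≤m) = <ᵇ-false n≤m

initialDescent : List ℕ → ℕ
initialDescent (x ∷ y ∷ _) = if y <ᵇ x then 1 else 0
initialDescent _           = 0

finalAscent : List ℕ → ℕ
finalAscent (x ∷ y ∷ [])        = if x <ᵇ y then 1 else 0
finalAscent (_ ∷ w@(_ ∷ _ ∷ _)) = finalAscent w
finalAscent _                   = 0

+-assoc₃ : ∀ a b c d → a + (b + c + d) ≡ a + b + c + d
+-assoc₃ a b c d = trans (sym (+-assoc a (b + c) d)) (cong (_+ d) (sym (+-assoc a b c)))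

occ132-∷-min : ∀ {m} w → All (m <_) w → occ132 (m ∷ w) ≡ initialDescent w + occ132 w
occ132-∷-min []              _               = refl
occ132-∷-min (_ ∷ [])        _               = refl
occ132-∷-min (x ∷ y ∷ w) (_ ∷ m<y ∷ _) rewrite <ᵇ-true m<y = refl

-- A consecutive triple whose middle entry is its minimum is neither a 132 nor a 231.
occ132-split : ∀ {m} u w → All (m <_) u → All (m <_) w →
  occ132 (u ++ m ∷ w) ≡ occ132 u + initialDescent w + occ132 w
occ132-split []              w _   m<w = occ132-∷-min w m<w
occ132-split (x ∷ [])        [] _   _  = refl
occ132-split (x ∷ [])        (y ∷ w) _ m<w@(m<y ∷ _)
  rewrite <ᵇ-false (<⇒≤ m<y) | ∧-zeroʳ (x <ᵇ y) = occ132-∷-min (y ∷ w) m<w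
occ132-split (x ∷ y ∷ [])    w (m<x ∷ m<u) m<w
  rewrite <ᵇ-false (<⇒≤ m<x) = occ132-split (y ∷ []) w m<u m<w
occ132-split (x ∷ y ∷ z ∷ u) w (_ ∷ m<u) m<w =
  trans (cong (xyz +_) (occ132-split (y ∷ z ∷ u) w m<u m<w)) (+-assoc₃ xyz _ _ _)
  where xyz = if (x <ᵇ z) ∧ (z <ᵇ y) then 1 else 0

occ231-∷-min : ∀ {m} w → All (m <_) w → occ231 (m ∷ w) ≡ occ231 w
occ231-∷-min []          _               = refl
occ231-∷-min (_ ∷ [])    _               = refl
occ231-∷-min (x ∷ y ∷ w) (_ ∷ m<y ∷ _) rewrite <ᵇ-false (<⇒≤ m<y) = refl

occ231-split : ∀ {m} u w → All (m <_) u → All (m <_) w →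
  occ231 (u ++ m ∷ w) ≡ occ231 u + finalAscent u + occ231 w
occ231-split []              w _   m<w = occ231-∷-min w m<w
occ231-split (x ∷ [])        [] _   _  = refl
occ231-split (x ∷ [])        (y ∷ w) (m<x ∷ _) m<w
  rewrite <ᵇ-false (<⇒≤ m<x) | ∧-zeroʳ (y <ᵇ x) = occ231-∷-min (y ∷ w) m<w
occ231-split (x ∷ y ∷ [])    w (m<x ∷ m<u) m<w
  rewrite <ᵇ-true m<x = cong (_ +_) (occ231-split (y ∷ []) w m<u m<w)
occ231-split (x ∷ y ∷ z ∷ u) w (_ ∷ m<u) m<w =
  trans (cong (xyz +_) (occ231-split (y ∷ z ∷ u) w m<u m<w)) (+-assoc₃ xyz _ _ _)
  where xyz = if (z <ᵇ x) ∧ (x <ᵇ y) then 1 else 0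

startsWithDescent : Tree → ℕ
startsWithDescent (node (node leaf leaf) _)        = 1
startsWithDescent (node l@(node (node _ _) _) _)   = startsWithDescent l
startsWithDescent _                                = 0

initialDescent-++ : ∀ u v → 2 ≤ length u → initialDescent (u ++ v) ≡ initialDescent u
initialDescent-++ (x ∷ y ∷ u) v _        = refl
initialDescent-++ (x ∷ [])    v (s≤s ())

initialDescent-∷-min : ∀ {m} w → All (m <_) w → initialDescent (m ∷ w) ≡ 0
initialDescent-∷-min []      _           = refl
initialDescent-∷-min (x ∷ w) (m<x ∷ _) rewrite <ᵇ-false (<⇒≤ m<x) = refl

initialDescent-encode-++ : ∀ o t {v} → 2 ≤ size t → initialDescent (encode o t ++ v) ≡ initialDescent (encode o t)
initialDescent-encode-++ o t 2≤ = initialDescent-++ (encode o t) _ (subst (2 ≤_) (sym (length-encode o t)) 2≤)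

initialDescent-encode : ∀ o t → initialDescent (encode o t) ≡ startsWithDescent t
initialDescent-encode o leaf                             = refl
initialDescent-encode o (node leaf r)                    = initialDescent-∷-min _ (right-above-root o leaf r)
initialDescent-encode o (node (node leaf leaf) r)        rewrite <ᵇ-true (≤-refl {suc o}) = refl
initialDescent-encode o (node l@(node (node _ _) _) r)   =
  trans (initialDescent-encode-++ (suc o) l (s≤s (s≤s z≤n))) (initialDescent-encode (suc o) l)
initialDescent-encode o (node l@(node leaf (node _ _)) r) =
  trans (initialDescent-encode-++ (suc o) l (s≤s (s≤s z≤n))) (initialDescent-encode (suc o) l)

finalAscent-∷ : ∀ x w → 2 ≤ length w → finalAscent (x ∷ w) ≡ finalAscent w
finalAscent-∷ x (y ∷ z ∷ w) _        = refl
finalAscent-∷ x (y ∷ [])    (s≤s ())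

finalAscent-++ : ∀ u v → 2 ≤ length v → finalAscent (u ++ v) ≡ finalAscent v
finalAscent-++ []      v _  = refl
finalAscent-++ (x ∷ u) v 2≤ = trans
  (finalAscent-∷ x (u ++ v) (≤-trans 2≤ (subst (length v ≤_) (sym (length-++ u)) (m≤n+m _ _))))
  (finalAscent-++ u v 2≤)

finalAscent-∷ʳ-min : ∀ {m} u → All (m <_) u → finalAscent (u ++ [ m ]) ≡ 0
finalAscent-∷ʳ-min []              _           = refl
finalAscent-∷ʳ-min (x ∷ [])        (m<x ∷ _) rewrite <ᵇ-false (<⇒≤ m<x) = refl
finalAscent-∷ʳ-min (x ∷ y ∷ [])    (_ ∷ m<u) = finalAscent-∷ʳ-min (y ∷ []) m<u
finalAscent-∷ʳ-min (x ∷ y ∷ z ∷ u) (_ ∷ m<u) = finalAscent-∷ʳ-min (y ∷ z ∷ u) m<u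

finalAscent-node : ∀ o l r → 2 ≤ size r → finalAscent (encode o (node l r)) ≡ finalAscent (encode (suc o + size l) r)
finalAscent-node o l r 2≤ = begin
  finalAscent (encode (suc o) l ++ [ o ] ++ encode (suc o + size l) r)   ≡⟨ cong finalAscent (++-assoc (encode (suc o) l) [ o ] _) ⟨
  finalAscent ((encode (suc o) l ++ [ o ]) ++ encode (suc o + size l) r) ≡⟨ finalAscent-++ (encode (suc o) l ++ [ o ]) _ 2≤length ⟩
  finalAscent (encode (suc o + size l) r)                                ∎
  where
  open ≡-Reasoning
  2≤length = subst (2 ≤_) (sym (length-encode (suc o + size l) r)) 2≤

finalAscent-encode : ∀ o t → finalAscent (encode o t) ≡ startsWithDescent (mirror t)
finalAscent-encode o leaf                          = refl
finalAscent-encode o (node l leaf)                 = finalAscent-∷ʳ-min (encode (suc o) l) (encode-lower (suc o) l)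
finalAscent-encode o (node l (node leaf leaf))
  rewrite finalAscent-++ (encode (suc o) l) (o ∷ suc o + size l ∷ []) (s≤s (s≤s z≤n))
        | <ᵇ-true (s≤s (m≤m+n o (size l)))       = refl
finalAscent-encode o (node l r@(node r₁ (node _ _))) =
  trans (finalAscent-node o l r (s≤s (≤-trans (s≤s z≤n) (m≤n+m _ (size r₁))))) (finalAscent-encode _ r)
finalAscent-encode o (node l r@(node (node _ _) leaf)) =
  trans (finalAscent-node o l r (s≤s (s≤s z≤n))) (finalAscent-encode _ r)

occ132-node : ∀ o l r → occ132 (encode o (node l r)) ≡ occ132 (encode (suc o) l) + startsWithDescent r + occ132 (encode (suc o + size l) r)
occ132-node o l r = trans (occ132-split L R (encode-lower (suc o) l) (right-above-root o l r))
  (cong (λ d → occ132 L + d + occ132 R) (initialDescent-encode (suc o + size l) r))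
  where
  L = encode (suc o) l
  R = encode (suc o + size l) r

occ231-node : ∀ o l r → occ231 (encode o (node l r)) ≡ occ231 (encode (suc o) l) + startsWithDescent (mirror l) + occ231 (encode (suc o + size l) r)
occ231-node o l r = trans (occ231-split L R (encode-lower (suc o) l) (right-above-root o l r))
  (cong (λ d → occ231 L + d + occ231 R) (finalAscent-encode (suc o) l))
  where
  L = encode (suc o) l
  R = encode (suc o + size l) r

+-swap-outer : ∀ x y z → x + y + z ≡ z + y + x
+-swap-outer x y z = begin
  x + y + z   ≡⟨ +-comm (x + y) z ⟩
  z + (x + y) ≡⟨ cong (z +_) (+-comm x y) ⟩
  z + (y + x) ≡⟨ +-assoc z y x ⟨
  z + y + x   ∎
  where open ≡-Reasoning

occ231-encode-mirror : ∀ o o′ t → occ231 (encode o (mirror t)) ≡ occ132 (encode o′ t)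
occ231-encode-mirror o o′ leaf       = refl
occ231-encode-mirror o o′ (node l r) = begin
  occ231 (encode o (node (mirror r) (mirror l)))
    ≡⟨ occ231-node o (mirror r) (mirror l) ⟩
  occ231 (encode o₁ (mirror r)) + startsWithDescent (mirror (mirror r)) + occ231 (encode o₂ (mirror l))
    ≡⟨ cong₂ (λ x y → x + startsWithDescent y + occ231 (encode o₂ (mirror l)))
             (occ231-encode-mirror o₁ p₂ r) (mirror-involutive r) ⟩
  occ132 (encode p₂ r) + startsWithDescent r + occ231 (encode o₂ (mirror l))
    ≡⟨ cong (occ132 (encode p₂ r) + startsWithDescent r +_) (occ231-encode-mirror o₂ p₁ l) ⟩
  occ132 (encode p₂ r) + startsWithDescent r + occ132 (encode p₁ l)
    ≡⟨ +-swap-outer (occ132 (encode p₂ r)) (startsWithDescent r) (occ132 (encode p₁ l)) ⟩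
  occ132 (encode p₁ l) + startsWithDescent r + occ132 (encode p₂ r)
    ≡⟨ occ132-node o′ l r ⟨
  occ132 (encode o′ (node l r))
    ∎
  where
  open ≡-Reasoning
  o₁ = suc o
  o₂ = suc o + size (mirror r)
  p₁ = suc o′
  p₂ = suc o′ + size l

-- word σ is entries σ; the rectangular version is what the inductions below need.
entries : ∀ {m n} → Vec (Fin m) n → List ℕ
entries v = toList (Vec.map toℕ v)

entry : ∀ {m n} → Vec (Fin m) n → Fin n → ℕ
entry v i = toℕ (lookup v i)

∈-entries⁺ : ∀ {m n} (v : Vec (Fin m) n) i → entry v i ∈ entries v
∈-entries⁺ (x ∷ v) fzero    = here refl
∈-entries⁺ (x ∷ v) (fsuc i) = there (∈-entries⁺ v i)

∈-entries⁻ : ∀ {m n} (v : Vec (Fin m) n) {x} → x ∈ entries v → ∃ λ i → entry v i ≡ x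
∈-entries⁻ (y ∷ v) (here refl) = fzero , refl
∈-entries⁻ (y ∷ v) (there x∈)  = let i , eq = ∈-entries⁻ v x∈ in fsuc i , eq

entries-injective : ∀ {m n} (v v′ : Vec (Fin m) n) → entries v ≡ entries v′ → v ≡ v′
entries-injective []      []        _  = refl
entries-injective (x ∷ v) (x′ ∷ v′) eq =
  cong₂ _∷_ (toℕ-injective (proj₁ (∷-injective eq))) (entries-injective v v′ (proj₂ (∷-injective eq)))

LookupInjective : ∀ {m n} → Vec (Fin m) n → Set
LookupInjective {n = n} v = ∀ (i j : Fin n) → lookup v i ≡ lookup v j → i ≡ j

lookupInjective⇒unique : ∀ {m n} (v : Vec (Fin m) n) → LookupInjective v → Unique (entries v)
lookupInjective⇒unique []      _   = []
lookupInjective⇒unique (x ∷ v) inj =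
  All.tabulate (λ y∈ x≡y → let i , eq = ∈-entries⁻ v y∈ in
    contradiction (inj fzero (fsuc i) (toℕ-injective (trans x≡y (sym eq)))) λ ())
  ∷ lookupInjective⇒unique v (λ i j → fsuc-injective ∘ inj (fsuc i) (fsuc j))

unique⇒lookupInjective : ∀ {m n} (v : Vec (Fin m) n) → Unique (entries v) → LookupInjective v
unique⇒lookupInjective (x ∷ v) _              fzero    fzero    _  = refl
unique⇒lookupInjective (x ∷ v) (x∉v ∷ _)      fzero    (fsuc j) eq =
  contradiction (cong toℕ eq) (All.lookup x∉v (∈-entries⁺ v j))
unique⇒lookupInjective (x ∷ v) (x∉v ∷ _)      (fsuc i) fzero    eq =
  contradiction (cong toℕ (sym eq)) (All.lookup x∉v (∈-entries⁺ v i))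
unique⇒lookupInjective (x ∷ v) (_ ∷ unique-v) (fsuc i) (fsuc j) eq =
  cong fsuc (unique⇒lookupInjective v unique-v i j eq)

-- An injection missing some y would factor through Fin k ≅ Fin (suc k) ∖ {y}.
injective⇒surjective : ∀ {n} (f : Fin n → Fin n) → (∀ {i j} → f i ≡ f j → i ≡ j) → ∀ y → ∃ λ x → f x ≡ y
injective⇒surjective {suc k} f f-inj y with any? (λ x → f x ≟ᶠ y)
... | yes hit = hit
... | no  miss = contradiction (injective⇒≤ punchOut∘f-injective) (1+n≰n {k})
  where
  y≢f : ∀ x → y ≢ f x
  y≢f x y≡fx = miss (x , sym y≡fx)
  punchOut∘f-injective : ∀ {i j} → punchOut (y≢f i) ≡ punchOut (y≢f j) → i ≡ j
  punchOut∘f-injective eq = f-inj (punchOut-injective (y≢f _) (y≢f _) eq)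

isPerm⇒↭ : ∀ {n} (σ : Vec (Fin n) n) → IsPerm σ → word σ ↭ interval 0 n
isPerm⇒↭ {n} σ σ-inj = ∼bag⇒↭ (unique∧set⇒bag (lookupInjective⇒unique σ σ-inj) (interval-unique 0 n) (mk⇔ to from))
  where
  to : ∀ {x} → x ∈ word σ → x ∈ interval 0 n
  to x∈ = let i , eq = ∈-entries⁻ σ x∈ in ∈-interval⁺ z≤n (subst (_< n) eq (toℕ<n (lookup σ i)))
  from : ∀ {x} → x ∈ interval 0 n → x ∈ word σ
  from x∈ = let x<n = proj₂ (∈-interval⁻ x∈)
                j , eq = injective⇒surjective (lookup σ) (σ-inj _ _) (fromℕ< x<n)
            in subst (_∈ word σ) (trans (cong toℕ eq) (toℕ-fromℕ< x<n)) (∈-entries⁺ σ j)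

↭⇒isPerm : ∀ {n} (σ : Vec (Fin n) n) → word σ ↭ interval 0 n → IsPerm σ
↭⇒isPerm {n} σ σ↭ = unique⇒lookupInjective σ (Unique-resp-↭ (↭⇒↭ₛ (↭-sym σ↭)) (interval-unique 0 n))

-- Entries are reduced mod n and missing ones filled with 0; these junk values never occur below.
padded : ∀ k m → List ℕ → Vec (Fin (suc k)) m
padded k zero    _       = []
padded k (suc m) []      = fzero ∷ padded k m []
padded k (suc m) (x ∷ w) = x mod suc k ∷ padded k m w

fromWord : ∀ n → List ℕ → Vec (Fin n) n
fromWord zero    _ = []
fromWord (suc k) w = padded k (suc k) w

entries-padded : ∀ k w → All (_< suc k) w → entries (padded k (length w) w) ≡ w
entries-padded k []      []             = refl
entries-padded k (x ∷ w) (x<1+k ∷ w<1+k) =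
  cong₂ _∷_ (trans (toℕ-fromℕ< _) (m<n⇒m%n≡m x<1+k)) (entries-padded k w w<1+k)

word-fromWord : ∀ {n} w → w ↭ interval 0 n → word (fromWord n w) ≡ w
word-fromWord {n} w w↭ = subst (λ k → word (fromWord k w) ≡ w) |w|≡n (fromWord-length w w<|w|)
  where
  |w|≡n : length w ≡ n
  |w|≡n = trans (↭-length w↭) (length-interval 0 n)
  w<|w| : All (_< length w) w
  w<|w| = All.tabulate (λ x∈ → subst (_ <_) (sym |w|≡n) (proj₂ (∈-interval⁻ (∈-resp-↭ w↭ x∈))))
  fromWord-length : ∀ u → All (_< length u) u → word (fromWord (length u) u) ≡ u
  fromWord-length []      _        = refl
  fromWord-length (x ∷ u) x∷u<|u| = entries-padded (length u) (x ∷ u) x∷u<|u|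

⊆-entries₂⁻ : ∀ {m n} (v : Vec (Fin m) n) {x y} → x ∷ y ∷ [] ⊆ entries v →
  ∃₂ λ i j → i <ᶠ j × entry v i ≡ x × entry v j ≡ y
⊆-entries₂⁻ (_ ∷ v) (_ ∷ʳ xy⊆) = let i , j , i<j , eqs = ⊆-entries₂⁻ v xy⊆ in fsuc i , fsuc j , s≤s i<j , eqs
⊆-entries₂⁻ (_ ∷ v) (refl ∷ y⊆) = let j , eq = ∈-entries⁻ v (to∈ y⊆) in fzero , fsuc j , s≤s z≤n , refl , eq

⊆-entries₃⁻ : ∀ {m n} (v : Vec (Fin m) n) {x y z} → x ∷ y ∷ z ∷ [] ⊆ entries v →
  ∃₂ λ i j → ∃ λ l → i <ᶠ j × j <ᶠ l × entry v i ≡ x × entry v j ≡ y × entry v l ≡ z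
⊆-entries₃⁻ (_ ∷ v) (_ ∷ʳ xyz⊆) =
  let i , j , l , i<j , j<l , eqs = ⊆-entries₃⁻ v xyz⊆ in fsuc i , fsuc j , fsuc l , s≤s i<j , s≤s j<l , eqs
⊆-entries₃⁻ (_ ∷ v) (refl ∷ yz⊆) =
  let j , l , j<l , eqs = ⊆-entries₂⁻ v yz⊆ in fzero , fsuc j , fsuc l , s≤s z≤n , s≤s j<l , refl , eqs

⊆-entries₂⁺ : ∀ {m n} (v : Vec (Fin m) n) i j → i <ᶠ j → entry v i ∷ entry v j ∷ [] ⊆ entries v
⊆-entries₂⁺ (_ ∷ v) fzero    (fsuc j) _         = refl ∷ from∈ (∈-entries⁺ v j)
⊆-entries₂⁺ (x ∷ v) (fsuc i) (fsuc j) (s≤s i<j) = toℕ x ∷ʳ ⊆-entries₂⁺ v i j i<j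

⊆-entries₃⁺ : ∀ {m n} (v : Vec (Fin m) n) i j l → i <ᶠ j → j <ᶠ l →
  entry v i ∷ entry v j ∷ entry v l ∷ [] ⊆ entries v
⊆-entries₃⁺ (_ ∷ v) fzero    (fsuc j) (fsuc l) _         (s≤s j<l) = refl ∷ ⊆-entries₂⁺ v j l j<l
⊆-entries₃⁺ (x ∷ v) (fsuc i) (fsuc j) (fsuc l) (s≤s i<j) (s≤s j<l) = toℕ x ∷ʳ ⊆-entries₃⁺ v i j l i<j j<l

avoids312⇒avoids312ʷ : ∀ {n} (σ : Vec (Fin n) n) → Avoids312 σ → Avoids312ʷ (word σ)
avoids312⇒avoids312ʷ σ av xyz⊆ with ⊆-entries₃⁻ σ xyz⊆
... | i , j , l , i<j , j<l , refl , refl , refl = av i j l i<j j<l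

avoids312ʷ⇒avoids312 : ∀ {n} (σ : Vec (Fin n) n) → Avoids312ʷ (word σ) → Avoids312 σ
avoids312ʷ⇒avoids312 σ av i j l i<j j<l = av (⊆-entries₃⁺ σ i j l i<j j<l)

-- The involution

encoding-size : ∀ {n} (σ : Vec (Fin n) n) t → word σ ≡ encode 0 t → size t ≡ n
encoding-size σ t σ≡ = trans (sym (length-encode 0 t)) (trans (cong length (sym σ≡)) (Vecₚ.length-toList (Vec.map _ σ)))

encoding-↭ : ∀ {n} (σ : Vec (Fin n) n) t → word σ ≡ encode 0 t → word σ ↭ interval 0 n
encoding-↭ σ t σ≡ = subst (λ k → word σ ↭ interval 0 k) (encoding-size σ t σ≡) (↭-trans (↭-reflexive σ≡) (encode-↭ 0 t))

encoding-isPerm : ∀ {n} (σ : Vec (Fin n) n) t → word σ ≡ encode 0 t → IsPerm σ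
encoding-isPerm σ t σ≡ = ↭⇒isPerm σ (encoding-↭ σ t σ≡)

encoding-avoids312 : ∀ {n} (σ : Vec (Fin n) n) t → word σ ≡ encode 0 t → Avoids312 σ
encoding-avoids312 σ t σ≡ = avoids312ʷ⇒avoids312 σ (subst Avoids312ʷ (sym σ≡) (encode-avoids312 0 t))

treeOf : ∀ {n} (σ : Vec (Fin n) n) → IsPerm σ → Avoids312 σ → ∃ λ t → word σ ≡ encode 0 t
treeOf {n} σ σ-perm σ-av = decode n 0 (word σ) (isPerm⇒↭ σ σ-perm) (avoids312⇒avoids312ʷ σ σ-av)

-- The identity off the 312-avoiding permutations, so that it is an involution of all of Vec (Fin n) n.
mirror312 : ∀ {n} → Vec (Fin n) n → Vec (Fin n) n
mirror312 {n} σ with isPerm? σ | avoids312? σ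
... | yes σ-perm | yes σ-av = fromWord n (encode 0 (mirror (proj₁ (treeOf σ σ-perm σ-av))))
... | _          | _        = σ

mirror312-encoding : ∀ {n} (σ : Vec (Fin n) n) t → word σ ≡ encode 0 t → mirror312 σ ≡ fromWord n (encode 0 (mirror t))
mirror312-encoding {n} σ t σ≡ with isPerm? σ | avoids312? σ
... | yes σ-perm | yes σ-av = let t₀ , σ≡₀ = treeOf σ σ-perm σ-av in
  cong (λ t′ → fromWord n (encode 0 (mirror t′))) (encode-injective 0 t₀ t (trans (sym σ≡₀) σ≡))
... | no ¬σ-perm | _        = contradiction (encoding-isPerm σ t σ≡) ¬σ-perm
... | yes _      | no ¬σ-av = contradiction (encoding-avoids312 σ t σ≡) ¬σ-av

word-mirror312 : ∀ {n} (σ : Vec (Fin n) n) t → word σ ≡ encode 0 t → word (mirror312 σ) ≡ encode 0 (mirror t)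
word-mirror312 {n} σ t σ≡ = trans (cong word (mirror312-encoding σ t σ≡))
  (word-fromWord _ (subst (λ k → encode 0 (mirror t) ↭ interval 0 k) size≡ (encode-↭ 0 (mirror t))))
  where size≡ = trans (size-mirror t) (encoding-size σ t σ≡)

mirror312-fixes : ∀ {n} (σ : Vec (Fin n) n) → ¬ (IsPerm σ × Avoids312 σ) → mirror312 σ ≡ σ
mirror312-fixes σ ¬good with isPerm? σ | avoids312? σ
... | yes σ-perm | yes σ-av = contradiction (σ-perm , σ-av) ¬good
... | no _       | _        = refl
... | yes _      | no _     = refl

mirror312-involutive : ∀ {n} (σ : Vec (Fin n) n) → mirror312 (mirror312 σ) ≡ σ
mirror312-involutive {n} σ with isPerm? σ ×-dec avoids312? σ
... | no ¬good = trans (cong mirror312 (mirror312-fixes σ ¬good)) (mirror312-fixes σ ¬good)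
... | yes (σ-perm , σ-av) = let t , σ≡ = treeOf σ σ-perm σ-av in begin
  mirror312 (mirror312 σ)                     ≡⟨ mirror312-encoding (mirror312 σ) (mirror t) (word-mirror312 σ t σ≡) ⟩
  fromWord n (encode 0 (mirror (mirror t)))   ≡⟨ cong (λ t′ → fromWord n (encode 0 t′)) (mirror-involutive t) ⟩
  fromWord n (encode 0 t)                     ≡⟨ cong (fromWord n) σ≡ ⟨
  fromWord n (word σ)                         ≡⟨ entries-injective _ σ (word-fromWord (word σ) (isPerm⇒↭ σ σ-perm)) ⟩
  σ                                           ∎
  where open ≡-Reasoning

mirror312-good : ∀ {n} (σ : Vec (Fin n) n) → IsPerm σ → Avoids312 σ →
  IsPerm (mirror312 σ) × Avoids312 (mirror312 σ) × occ231 (word (mirror312 σ)) ≡ occ132 (word σ)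
mirror312-good σ σ-perm σ-av =
  encoding-isPerm _ (mirror t) τ≡ , encoding-avoids312 _ (mirror t) τ≡ ,
  trans (cong occ231 τ≡) (trans (occ231-encode-mirror 0 0 t) (cong occ132 (sym σ≡)))
  where
  t = proj₁ (treeOf σ σ-perm σ-av)
  σ≡ = proj₂ (treeOf σ σ-perm σ-av)
  τ≡ = word-mirror312 σ t σ≡

mirror312-good⁻ : ∀ {n} (σ : Vec (Fin n) n) → IsPerm (mirror312 σ) → Avoids312 (mirror312 σ) → IsPerm σ × Avoids312 σ
mirror312-good⁻ σ τ-perm τ-av = let σσ-perm , σσ-av , _ = mirror312-good (mirror312 σ) τ-perm τ-av in
  subst IsPerm (mirror312-involutive σ) σσ-perm , subst Avoids312 (mirror312-involutive σ) σσ-av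

theorem12 : (n k : ℕ) → a occ132 n k ≡ a occ231 n k
theorem12 n k = length-filter-involution mirror312 mirror312-involutive P? Q? (allVecs-unique n n) ∈-allVecs (to , from)
  where
  P? = λ (σ : Vec (Fin n) n) → isPerm? σ ×-dec avoids312? σ ×-dec (occ132 (word σ) ≟ k)
  Q? = λ (σ : Vec (Fin n) n) → isPerm? σ ×-dec avoids312? σ ×-dec (occ231 (word σ) ≟ k)
  to : ∀ {σ} → IsPerm σ × Avoids312 σ × occ132 (word σ) ≡ k →
    IsPerm (mirror312 σ) × Avoids312 (mirror312 σ) × occ231 (word (mirror312 σ)) ≡ k
  to {σ} (σ-perm , σ-av , occ≡k) = let τ-perm , τ-av , occ≡ = mirror312-good σ σ-perm σ-av in
    τ-perm , τ-av , trans occ≡ occ≡k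
  from : ∀ {σ} → IsPerm (mirror312 σ) × Avoids312 (mirror312 σ) × occ231 (word (mirror312 σ)) ≡ k →
    IsPerm σ × Avoids312 σ × occ132 (word σ) ≡ k
  from {σ} (τ-perm , τ-av , occ≡k) = let σ-perm , σ-av = mirror312-good⁻ σ τ-perm τ-av in
    σ-perm , σ-av , trans (sym (proj₂ (proj₂ (mirror312-good σ σ-perm σ-av)))) occ≡k
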